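{- Let $n\ge1$ and $\Xi_n=[L_{2n-1}+1,L_{2n+1}]$. Let $u_1,u_2,\dots,u_k$ be the distinct words among $\beta^-(N)$, $N\in\Xi_n$, listed in the order of their first occurrence as $N$ increases through $\Xi_n$, and let $c_j=Z^{ -1}(u_j')$, where $u_j'$ is $u_j$ with its final two letters $01$ removed. Then $k=F_{2n}$, and the sequence $(c_1,\dots,c_{F_{2n}})=\Pi^\beta_{2n}$ is the orbit of $F_{2n}-1$ under addition of $F_{2n-2}$ in $\mathbb Z/F_{2n}\mathbb Z$: $$c_1=F_{2n}-1,\qquad c_{j+1}\equiv c_j+F_{2n-2}\pmod{F_{2n}}\quad (1\le j\le F_{2n}-1).$$
   Context: Let $\varphi=(1+\sqrt5)/2$. Every integer $N\ge1$ has a unique base phi expansion $N=\sum_{i\in\mathbb Z} d_i\varphi^i$ with $d_i\in\{0,1\}$, finitely many nonzero, $d_id_{i+1}=0$; with $R$ the smallest index with $d_R=1$, $\beta^-(N)=d_{ -1}\cdots d_R$. For $N\in\Xi_n$, $\beta^-(N)$ has length $2n$ and ends in $01$. Fibonacci numbers $F_0=0,F_1=1$, $F_n=F_{n-1}+F_{n-2}$; Lucas numbers $L_0=2,L_1=1$, $L_n=L_{n-1}+L_{n-2}$. For a word $e_k\cdots e_0$ over $\{0,1\}$ with no factor $11$, $Z^{ -1}(e_k\cdots e_0)=\sum_i e_iF_{i+2}$ (the empty word gives $0$). -}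

module Defs where

open import Data.Bool using (Bool; true; false)
import Data.Bool.Properties as BoolP
open import Data.Nat using (ℕ; zero; suc; _+_; _*_; _∸_; _≤_; _%_)
open import Data.Integer as ℤ using (ℤ; +_)
open import Data.List using (List; []; _∷_; _++_; reverse; map; upTo; deduplicate; length; iterate; take; last)
import Data.List.Properties as ListP
open import Data.Maybe using (Maybe; just)
open import Data.Product using (_×_; _,_; Σ; ∃)
open import Data.Sum using (_⊎_)
open import Data.Empty using (⊥)
open import Data.Unit using (⊤)
open import Relation.Binary.PropositionalEquality using (_≡_)

fib : ℕ → ℕ
fib 0 = 0
fib 1 = 1
fib (suc (suc n)) = fib (suc n) + fib n

lucas : ℕ → ℕ
lucas 0 = 2
lucas 1 = 1
lucas (suc (suc n)) = lucas (suc n) + lucas n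

-- Digits: false = 0, true = 1.  Words are lists of digits, written left to right.
Word : Set
Word = List Bool

NoEleven : Word → Set
NoEleven [] = ⊤
NoEleven (_ ∷ []) = ⊤
NoEleven (true ∷ true ∷ _) = ⊥
NoEleven (_ ∷ y ∷ ys) = NoEleven (y ∷ ys)

-- Exact arithmetic in ℤ[φ]: the pair (a , b) represents a + b φ, where φ² = φ + 1.
ℤφ : Set
ℤφ = ℤ × ℤ

digitℤ : Bool → ℤ
digitℤ true = + 1
digitℤ false = + 0

addDigit : Bool → ℤφ → ℤφ
addDigit d (a , b) = (a ℤ.+ digitℤ d , b)

-- (a + bφ)·φ = b + (a + b)φ
mulφ : ℤφ → ℤφ
mulφ (a , b) = (b , a ℤ.+ b)

-- (a + bφ)·φ⁻¹ = (a + bφ)(φ - 1) = (b - a) + aφ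
mulφinv : ℤφ → ℤφ
mulφinv (a , b) = (b ℤ.- a , a)

-- value of d_p ⋯ d_0 (highest index first):  Σ d_i φ^i
valPos : Word → ℤφ
valPos = go (+ 0 , + 0)
  where
  go : ℤφ → Word → ℤφ
  go acc [] = acc
  go acc (d ∷ ds) = go (addDigit d (mulφ acc)) ds

-- value of d_{-1} d_{-2} ⋯ d_{-m}:  Σ_{i=1}^m d_{-i} φ^{-i}
valNeg : Word → ℤφ
valNeg [] = (+ 0 , + 0)
valNeg (d ∷ ds) = mulφinv (addDigit d (valNeg ds))

_+φ_ : ℤφ → ℤφ → ℤφ
(a , b) +φ (c , d) = (a ℤ.+ c , b ℤ.+ d)

EmptyOrEndsIn1 : Word → Set
EmptyOrEndsIn1 w = (w ≡ []) ⊎ (last w ≡ just true)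

-- That is, there is a base phi expansion
-- N = Σ d_i φ^i (digits in {0,1}, finitely many nonzero, no two consecutive 1s)
-- whose nonnegative part is pos = d_p ⋯ d_0 and whose negative part is
-- w = d_{-1} ⋯ d_R, where R is the smallest index with d_R = 1
-- (so w is empty or ends in 1).
IsBetaMinus : ℕ → Word → Set
IsBetaMinus N w =
  Σ Word λ pos →
    NoEleven (pos ++ w) × EmptyOrEndsIn1 w
      × ((valPos pos +φ valNeg w) ≡ (+ N , + 0))

-- Z⁻¹(e_k ⋯ e_0) = Σ e_i F_{i+2}
Zinv : Word → ℕ
Zinv w = go 0 (reverse w)
  where
  dig : Bool → ℕ
  dig true = 1
  dig false = 0
  go : ℕ → Word → ℕ
  go i [] = 0
  go i (e ∷ es) = dig e * fib (i + 2) + go (suc i) es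

dropLast2 : Word → Word
dropLast2 w = take (length w ∸ 2) w

Xi : ℕ → List ℕ
Xi n = map (λ i → lucas (2 * n ∸ 1) + 1 + i) (upTo (lucas (2 * n + 1) ∸ lucas (2 * n ∸ 1)))

InXi : ℕ → ℕ → Set
InXi n N = (lucas (2 * n ∸ 1) + 1 ≤ N) × (N ≤ lucas (2 * n + 1))

distinctWords : (ℕ → Word) → ℕ → List Word
distinctWords b n = deduplicate (ListP.≡-dec BoolP._≟_) (map b (Xi n))

cSeq : (ℕ → Word) → ℕ → List ℕ
cSeq b n = map (λ u → Zinv (dropLast2 u)) (distinctWords b n)

-- orbit of F_{2n} - 1 under x ↦ x + F_{2n-2} in ℤ/F_{2n}ℤ, of length F_{2n}
-- (the modulus F_{2n} is ≥ 1 for n ≥ 1; residues are taken in {0, …, F_{2n} - 1})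
modN : ℕ → ℕ → ℕ
modN zero x = x
modN (suc m) x = x % suc m

orbit : ℕ → List ℕ
orbit n = iterate (λ x → modN (fib (2 * n)) (x + fib (2 * n ∸ 2))) (fib (2 * n) ∸ 1) (fib (2 * n))

-- The integers of Ξ_n fall into maximal runs sharing one word β⁻: a single integer when
-- the word starts with 1, three consecutive ones when it starts with 0.  The runs of Ξ_{n+1}
-- arise from those of Ξ_n by prepending 10 and 00 (and 01 when the word starts with 0) to
-- the word while appending two digits to the integer parts; all values are computed exactly
-- in ℤ[φ].  From one run to the next the φ-coefficient of the word's value drops by one, so
-- there are F_{2n} runs with distinct words, and on the Zeckendorf indices c the same
-- recursion is the rotation by F_{2n-2} modulo F_{2n}.  That β⁻ is well defined (so that any
-- choice b of it reproduces these words) follows from Zeckendorf uniqueness after shifting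
-- the radix point past all negative digits.
module Submission where

open import Data.Bool using (Bool; true; false)
import Data.Bool.Properties as Bool
open import Data.Empty using (⊥; ⊥-elim)
open import Data.Integer as ℤ using (ℤ; +_)
import Data.Integer.Properties as ℤ
open import Data.Integer.Tactic.RingSolver using (solve-∀)
open import Data.List
  using (List; []; _∷_; _++_; [_]; length; reverse; replicate; concatMap; take; map; iterate; applyUpTo; upTo;
         deduplicate; filter)
import Data.List.Properties as List
open import Data.List.Relation.Unary.All as All using (All)
import Data.List.Relation.Unary.All.Properties as All
open import Data.Nat using (ℕ; zero; suc; _+_; _*_; _∸_; _≤_; _<_; s≤s; z≤n; _⊓_)
import Data.Nat.DivMod as ℕ
import Data.Nat.Properties as ℕ
import Data.Nat.Tactic.RingSolver as ℕ-Solver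
open import Data.Product using (Σ; ∃; _×_; _,_; proj₁; proj₂)
open import Data.Sum using (inj₁; inj₂)
open import Data.Unit using (⊤; tt)
open import Function using (id; _∘_; _$_)
open import Relation.Binary.PropositionalEquality
  using (_≡_; refl; sym; trans; cong; cong₂; subst; subst₂; module ≡-Reasoning)
open import Relation.Nullary using (¬_; ¬?; Dec)

open import Defs

-- valPos and Zinv are accumulator loops local to their where blocks, so they cannot be named
-- directly; each loop is recovered as the solution of a meta, pinned down by an equation
-- generalised over the accumulator.
mutual
  horner : ℤφ → Word → ℤφ
  horner = _

  private
    valPos-∷ : ∀ d ds → valPos (d ∷ ds) ≡ horner (addDigit d (mulφ (+ 0 , + 0))) ds
    valPos-∷ d ds with addDigit d (mulφ (+ 0 , + 0))
    ... | acc = refl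

mutual
  fibSum : Word → ℕ → Word → ℕ
  fibSum = _

  Zinv≡fibSum : ∀ w → Zinv w ≡ fibSum w 0 (reverse w)
  Zinv≡fibSum w with reverse w
  ... | es with 0
  ... | i = refl

horner-++ : ∀ acc xs ys → horner acc (xs ++ ys) ≡ horner (horner acc xs) ys
horner-++ acc [] ys = refl
horner-++ acc (x ∷ xs) ys = horner-++ _ xs ys

valPos-++ : ∀ xs ys → valPos (xs ++ ys) ≡ horner (valPos xs) ys
valPos-++ = horner-++ _

bit : Bool → ℕ
bit true = 1
bit false = 0

digitℤ≡bit : ∀ d → digitℤ d ≡ + bit d
digitℤ≡bit true = refl
digitℤ≡bit false = refl

fibSum-∷ : ∀ w i e es → fibSum w i (e ∷ es) ≡ bit e * fib (suc (suc i)) + fibSum w (suc i) es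
fibSum-∷ w i true es rewrite ℕ.+-comm i 2 = refl
fibSum-∷ w i false es = refl

fibSum-irrelevant : ∀ w w′ i es → fibSum w i es ≡ fibSum w′ i es
fibSum-irrelevant w w′ i [] = refl
fibSum-irrelevant w w′ i (e ∷ es)
  rewrite fibSum-∷ w i e es | fibSum-∷ w′ i e es | fibSum-irrelevant w w′ (suc i) es = refl

fibSum-∷ʳ : ∀ w i es x → fibSum w i (es ++ [ x ]) ≡ fibSum w i es + bit x * fib (suc (suc (i + length es)))
fibSum-∷ʳ w i [] x rewrite fibSum-∷ w i x [] | ℕ.+-identityʳ i = ℕ.+-identityʳ _
fibSum-∷ʳ w i (e ∷ es) x
  rewrite fibSum-∷ w i e (es ++ [ x ]) | fibSum-∷ w i e es | fibSum-∷ʳ w (suc i) es x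
        | ℕ.+-suc i (length es) = sym (ℕ.+-assoc (bit e * fib (suc (suc i))) _ _)

Zinv-∷ : ∀ x u → Zinv (x ∷ u) ≡ bit x * fib (suc (suc (length u))) + Zinv u
Zinv-∷ x u
  rewrite Zinv≡fibSum (x ∷ u) | Zinv≡fibSum u | List.unfold-reverse x u
        | fibSum-∷ʳ (x ∷ u) 0 (reverse u) x | List.length-reverse u
        | fibSum-irrelevant (x ∷ u) u 0 (reverse u)
  = ℕ.+-comm (fibSum u 0 (reverse u)) _

Zinv-replicate-false : ∀ k u → Zinv (replicate k false ++ u) ≡ Zinv u
Zinv-replicate-false zero u = refl
Zinv-replicate-false (suc k) u rewrite Zinv-∷ false (replicate k false ++ u) = Zinv-replicate-false k u

-- Since φ^i = F_{i-1} + F_i φ and F_{i-1} + 2 F_i = F_{i+2}, the integer a + 2b recovers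
-- Z⁻¹ of a word from its value a + bφ.
fibSum-valPos : ∀ w k es → + fibSum w k es ≡
  + fib (suc (suc k)) ℤ.* (proj₁ (valPos (reverse es)) ℤ.+ proj₂ (valPos (reverse es)))
    ℤ.+ + fib (suc k) ℤ.* proj₂ (valPos (reverse es))
fibSum-valPos w k [] = zero-identity (+ fib (suc (suc k))) (+ fib (suc k))
  where
  zero-identity : ∀ (x y : ℤ) → + 0 ≡ x ℤ.* (+ 0 ℤ.+ + 0) ℤ.+ y ℤ.* + 0
  zero-identity = solve-∀
fibSum-valPos w k (e ∷ es)
  rewrite List.unfold-reverse e es | valPos-++ (reverse es) [ e ] | fibSum-∷ w k e es | digitℤ≡bit e =
  trans (cong₂ ℤ._+_ (ℤ.pos-* (bit e) (fib (suc (suc k)))) (fibSum-valPos w (suc k) es))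
        (fib-recurrence (+ bit e) (+ fib (suc (suc k))) (+ fib (suc k))
          (proj₁ (valPos (reverse es))) (proj₂ (valPos (reverse es))))
  where
  fib-recurrence : ∀ (δ F₂ F₁ a b : ℤ) →
    δ ℤ.* F₂ ℤ.+ ((F₂ ℤ.+ F₁) ℤ.* (a ℤ.+ b) ℤ.+ F₂ ℤ.* b)
    ≡ F₂ ℤ.* ((b ℤ.+ δ) ℤ.+ (a ℤ.+ b)) ℤ.+ F₁ ℤ.* (a ℤ.+ b)
  fib-recurrence = solve-∀

Zinv-valPos : ∀ u → + Zinv u ≡ proj₁ (valPos u) ℤ.+ (proj₂ (valPos u) ℤ.+ proj₂ (valPos u))
Zinv-valPos u
  with fibSum-valPos u 0 (reverse u)
... | e rewrite List.reverse-involutive u | sym (Zinv≡fibSum u) =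
  trans e (simplify (proj₁ (valPos u)) (proj₂ (valPos u)))
  where
  simplify : ∀ (a b : ℤ) → + 1 ℤ.* (a ℤ.+ b) ℤ.+ + 1 ℤ.* b ≡ a ℤ.+ (b ℤ.+ b)
  simplify = solve-∀

NoEleven-false∷ : ∀ u → NoEleven u → NoEleven (false ∷ u)
NoEleven-false∷ [] h = tt
NoEleven-false∷ (y ∷ ys) h = h

NoEleven-∷⁻ : ∀ x u → NoEleven (x ∷ u) → NoEleven u
NoEleven-∷⁻ x [] h = tt
NoEleven-∷⁻ true (true ∷ ys) ()
NoEleven-∷⁻ true (false ∷ ys) h = h
NoEleven-∷⁻ false (y ∷ ys) h = h

NoEleven-++⁻ˡ : ∀ xs ys → NoEleven (xs ++ ys) → NoEleven xs
NoEleven-++⁻ˡ [] ys h = tt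
NoEleven-++⁻ˡ (x ∷ []) ys h = tt
NoEleven-++⁻ˡ (true ∷ true ∷ xs) ys ()
NoEleven-++⁻ˡ (true ∷ false ∷ xs) ys h = NoEleven-++⁻ˡ (false ∷ xs) ys h
NoEleven-++⁻ˡ (false ∷ y ∷ xs) ys h = NoEleven-++⁻ˡ (y ∷ xs) ys h

NoEleven-glue : ∀ xs a ys → NoEleven (xs ++ [ a ]) → NoEleven (a ∷ ys) → NoEleven (xs ++ a ∷ ys)
NoEleven-glue [] a ys h₁ h₂ = h₂
NoEleven-glue (true ∷ []) true ys () h₂
NoEleven-glue (true ∷ []) false ys h₁ h₂ = h₂
NoEleven-glue (false ∷ []) a ys h₁ h₂ = h₂
NoEleven-glue (true ∷ true ∷ xs) a ys () h₂
NoEleven-glue (true ∷ false ∷ xs) a ys h₁ h₂ = NoEleven-glue (false ∷ xs) a ys h₁ h₂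
NoEleven-glue (false ∷ y ∷ xs) a ys h₁ h₂ = NoEleven-glue (y ∷ xs) a ys h₁ h₂

NoEleven-∷ʳ-false : ∀ xs → NoEleven xs → NoEleven (xs ++ [ false ])
NoEleven-∷ʳ-false [] h = tt
NoEleven-∷ʳ-false (true ∷ []) h = tt
NoEleven-∷ʳ-false (false ∷ []) h = tt
NoEleven-∷ʳ-false (true ∷ true ∷ xs) ()
NoEleven-∷ʳ-false (true ∷ false ∷ xs) h = NoEleven-∷ʳ-false (false ∷ xs) h
NoEleven-∷ʳ-false (false ∷ y ∷ xs) h = NoEleven-∷ʳ-false (y ∷ xs) h

NoEleven-++-false∷ : ∀ xs ys → NoEleven xs → NoEleven (false ∷ ys) → NoEleven (xs ++ false ∷ ys)
NoEleven-++-false∷ xs ys h₁ h₂ = NoEleven-glue xs false ys (NoEleven-∷ʳ-false xs h₁) h₂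

NoEleven-replicate-false : ∀ k → NoEleven (replicate k false)
NoEleven-replicate-false zero = tt
NoEleven-replicate-false (suc k) = NoEleven-false∷ (replicate k false) (NoEleven-replicate-false k)

NoEleven-++-zeros : ∀ xs k → NoEleven xs → NoEleven (xs ++ replicate k false)
NoEleven-++-zeros xs zero h rewrite List.++-identityʳ xs = h
NoEleven-++-zeros xs (suc k) h = NoEleven-++-false∷ xs _ h (NoEleven-replicate-false (suc k))

NoEleven-zeros-++ : ∀ k u → NoEleven u → NoEleven (replicate k false ++ u)
NoEleven-zeros-++ zero u h = h
NoEleven-zeros-++ (suc k) u h = NoEleven-false∷ (replicate k false ++ u) (NoEleven-zeros-++ k u h)

fib-mono : ∀ n → fib n ≤ fib (suc n)
fib-mono zero = z≤n
fib-mono (suc n) = ℕ.m≤m+n (fib (suc n)) (fib n)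

Zinv<fib : ∀ u → NoEleven u → Zinv u < fib (suc (suc (length u)))
Zinv<fib [] h = s≤s z≤n
Zinv<fib (false ∷ u) h rewrite Zinv-∷ false u =
  ℕ.<-≤-trans (Zinv<fib u (NoEleven-∷⁻ false u h)) (fib-mono (suc (suc (length u))))
Zinv<fib (true ∷ []) h = s≤s (s≤s z≤n)
Zinv<fib (true ∷ true ∷ u) ()
Zinv<fib (true ∷ false ∷ u) h
  rewrite Zinv-∷ true (false ∷ u) | Zinv-∷ false u | ℕ.*-identityˡ (fib (suc (suc (length (false ∷ u))))) =
  ℕ.+-monoʳ-< (fib (suc (suc (length (false ∷ u))))) (Zinv<fib u (NoEleven-∷⁻ false u h))

Zinv-false<true : ∀ u v → length u ≡ length v → NoEleven (false ∷ v) → Zinv (false ∷ v) < Zinv (true ∷ u)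
Zinv-false<true u v |u|≡|v| h
  rewrite Zinv-∷ false v | Zinv-∷ true u | |u|≡|v| | ℕ.*-identityˡ (fib (suc (suc (length v)))) =
  ℕ.<-≤-trans (Zinv<fib v (NoEleven-∷⁻ false v h)) (ℕ.m≤m+n _ _)

Zinv-injective : ∀ u v → length u ≡ length v → NoEleven u → NoEleven v → Zinv u ≡ Zinv v → u ≡ v
Zinv-injective [] [] _ _ _ _ = refl
Zinv-injective (true ∷ u) (true ∷ v) l hu hv e =
  cong (true ∷_) (Zinv-injective u v |u|≡|v| (NoEleven-∷⁻ true u hu) (NoEleven-∷⁻ true v hv) (ℕ.+-cancelˡ-≡ _ _ _ heads))
  where
  open ≡-Reasoning
  |u|≡|v| = ℕ.suc-injective l
  heads : 1 * fib (suc (suc (length u))) + Zinv u ≡ 1 * fib (suc (suc (length u))) + Zinv v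
  heads = begin
    1 * fib (suc (suc (length u))) + Zinv u ≡⟨ Zinv-∷ true u ⟨
    Zinv (true ∷ u)                          ≡⟨ e ⟩
    Zinv (true ∷ v)                          ≡⟨ Zinv-∷ true v ⟩
    1 * fib (suc (suc (length v))) + Zinv v ≡⟨ cong (λ k → 1 * fib (suc (suc k)) + Zinv v) |u|≡|v| ⟨
    1 * fib (suc (suc (length u))) + Zinv v ∎
Zinv-injective (false ∷ u) (false ∷ v) l hu hv e =
  cong (false ∷_) (Zinv-injective u v (ℕ.suc-injective l) (NoEleven-∷⁻ false u hu) (NoEleven-∷⁻ false v hv)
    (trans (sym (Zinv-∷ false u)) (trans e (Zinv-∷ false v))))
Zinv-injective (true ∷ u) (false ∷ v) l hu hv e =
  ⊥-elim (ℕ.<-irrefl (sym e) (Zinv-false<true u v (ℕ.suc-injective l) hv))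
Zinv-injective (false ∷ u) (true ∷ v) l hu hv e =
  ⊥-elim (ℕ.<-irrefl e (Zinv-false<true v u (sym (ℕ.suc-injective l)) hu))

-- Uniqueness of β⁻

mulφ^ : ℕ → ℤφ → ℤφ
mulφ^ zero x = x
mulφ^ (suc k) x = mulφ^ k (mulφ x)

mulφ^-+ : ∀ a b x → mulφ^ (a + b) x ≡ mulφ^ b (mulφ^ a x)
mulφ^-+ zero b x = refl
mulφ^-+ (suc a) b x = mulφ^-+ a b (mulφ x)

mulφ-shift : ∀ x d v → mulφ (x +φ mulφinv (addDigit d v)) ≡ addDigit d (mulφ x) +φ v
mulφ-shift (x₁ , x₂) d (v₁ , v₂) = cong₂ _,_ (first x₂ v₁ (digitℤ d)) (second x₁ x₂ v₁ v₂ (digitℤ d))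
  where
  first : ∀ (x₂ v₁ δ : ℤ) → x₂ ℤ.+ (v₁ ℤ.+ δ) ≡ (x₂ ℤ.+ δ) ℤ.+ v₁
  first = solve-∀
  second : ∀ (x₁ x₂ v₁ v₂ δ : ℤ) → (x₁ ℤ.+ (v₂ ℤ.- (v₁ ℤ.+ δ))) ℤ.+ (x₂ ℤ.+ (v₁ ℤ.+ δ)) ≡ (x₁ ℤ.+ x₂) ℤ.+ v₂
  second = solve-∀

mulφ^-valNeg : ∀ x w → mulφ^ (length w) (x +φ valNeg w) ≡ horner x w
mulφ^-valNeg (x₁ , x₂) [] = cong₂ _,_ (ℤ.+-identityʳ x₁) (ℤ.+-identityʳ x₂)
mulφ^-valNeg x (d ∷ w) = trans (cong (mulφ^ (length w)) (mulφ-shift x d (valNeg w))) (mulφ^-valNeg _ w)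

horner-zeros : ∀ k x → horner x (replicate k false) ≡ mulφ^ k x
horner-zeros zero x = refl
horner-zeros (suc k) (x₁ , x₂) =
  trans (cong (λ y → horner y (replicate k false)) (cong₂ _,_ (ℤ.+-identityʳ x₂) refl))
        (horner-zeros k (x₂ , x₁ ℤ.+ x₂))

valPos-shifted : ∀ N p w k → valPos p +φ valNeg w ≡ (+ N , + 0) →
  valPos (p ++ w ++ replicate k false) ≡ mulφ^ (length w + k) (+ N , + 0)
valPos-shifted N p w k e = begin
  valPos (p ++ w ++ replicate k false)             ≡⟨ cong valPos (sym (List.++-assoc p w _)) ⟩
  valPos ((p ++ w) ++ replicate k false)           ≡⟨ valPos-++ (p ++ w) _ ⟩
  horner (valPos (p ++ w)) (replicate k false)     ≡⟨ horner-zeros k _ ⟩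
  mulφ^ k (valPos (p ++ w))                        ≡⟨ cong (mulφ^ k) (valPos-++ p w) ⟩
  mulφ^ k (horner (valPos p) w)                    ≡⟨ cong (mulφ^ k) (mulφ^-valNeg (valPos p) w) ⟨
  mulφ^ k (mulφ^ (length w) (valPos p +φ valNeg w)) ≡⟨ cong (λ x → mulφ^ k (mulφ^ (length w) x)) e ⟩
  mulφ^ k (mulφ^ (length w) (+ N , + 0))           ≡⟨ mulφ^-+ (length w) k _ ⟨
  mulφ^ (length w + k) (+ N , + 0)                 ∎
  where open ≡-Reasoning

EmptyOrEndsIn1-∷⁻ : ∀ x w → EmptyOrEndsIn1 (x ∷ w) → EmptyOrEndsIn1 w
EmptyOrEndsIn1-∷⁻ x [] h = inj₁ refl
EmptyOrEndsIn1-∷⁻ x (y ∷ ys) (inj₁ ())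
EmptyOrEndsIn1-∷⁻ x (y ∷ ys) (inj₂ e) = inj₂ e

zeros-prefix-EmptyOrEndsIn1 : ∀ a w ys → replicate a false ≡ w ++ ys → EmptyOrEndsIn1 w → w ≡ []
zeros-prefix-EmptyOrEndsIn1 a [] ys e h = refl
zeros-prefix-EmptyOrEndsIn1 zero (x ∷ w) ys () h
zeros-prefix-EmptyOrEndsIn1 (suc a) (x ∷ w) ys e h with List.∷-injective e
... | refl , e′ with zeros-prefix-EmptyOrEndsIn1 a w ys e′ (EmptyOrEndsIn1-∷⁻ x w h)
zeros-prefix-EmptyOrEndsIn1 (suc a) (x ∷ []) ys e (inj₁ ()) | refl , e′ | refl
zeros-prefix-EmptyOrEndsIn1 (suc a) (x ∷ []) ys e (inj₂ ()) | refl , e′ | refl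

trailing-zeros-injective : ∀ w₁ w₂ a b → w₁ ++ replicate a false ≡ w₂ ++ replicate b false →
  EmptyOrEndsIn1 w₁ → EmptyOrEndsIn1 w₂ → w₁ ≡ w₂
trailing-zeros-injective [] [] a b e h₁ h₂ = refl
trailing-zeros-injective [] (x ∷ w) a b e h₁ h₂ with zeros-prefix-EmptyOrEndsIn1 a (x ∷ w) _ e h₂
... | ()
trailing-zeros-injective (x ∷ w) [] a b e h₁ h₂ with zeros-prefix-EmptyOrEndsIn1 b (x ∷ w) _ (sym e) h₁
... | ()
trailing-zeros-injective (x ∷ w₁) (y ∷ w₂) a b e h₁ h₂ with List.∷-injective e
... | refl , e′ = cong (x ∷_) (trailing-zeros-injective w₁ w₂ a b e′
  (EmptyOrEndsIn1-∷⁻ x w₁ h₁) (EmptyOrEndsIn1-∷⁻ x w₂ h₂))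

++-cancel-prefix : ∀ {A : Set} (xs xs′ ys ys′ : List A) → length xs ≡ length xs′ →
  xs ++ ys ≡ xs′ ++ ys′ → ys ≡ ys′
++-cancel-prefix [] [] ys ys′ _ e = e
++-cancel-prefix (x ∷ xs) (x′ ∷ xs′) ys ys′ l e =
  ++-cancel-prefix xs xs′ ys ys′ (ℕ.suc-injective l) (List.∷-injectiveʳ e)

++-cancel-suffix-length : ∀ {A : Set} (xs xs′ ys ys′ : List A) → length ys ≡ length ys′ →
  xs ++ ys ≡ xs′ ++ ys′ → ys ≡ ys′
++-cancel-suffix-length xs xs′ ys ys′ l e = ++-cancel-prefix xs xs′ ys ys′ |xs|≡|xs′| e
  where
  |xs|≡|xs′| : length xs ≡ length xs′
  |xs|≡|xs′| = ℕ.+-cancelʳ-≡ (length ys) _ _ (begin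
    length xs + length ys   ≡⟨ List.length-++ xs ⟨
    length (xs ++ ys)       ≡⟨ cong length e ⟩
    length (xs′ ++ ys′)     ≡⟨ List.length-++ xs′ ⟩
    length xs′ + length ys′ ≡⟨ cong (λ t → length xs′ + t) l ⟨
    length xs′ + length ys  ∎)
    where open ≡-Reasoning

length-++-replicate : ∀ (u : Word) k → length (u ++ replicate k false) ≡ length u + k
length-++-replicate u k = trans (List.length-++ u) (cong (λ t → length u + t) (List.length-replicate k))

-- Padding both expansions with zeros to the same number of negative digits turns them into
-- Zeckendorf words of the same integer φ^K N; Zeckendorf uniqueness then identifies them.
IsBetaMinus-unique : ∀ N w₁ w₂ → IsBetaMinus N w₁ → IsBetaMinus N w₂ → w₁ ≡ w₂
IsBetaMinus-unique N w₁ w₂ (p₁ , ne₁ , end₁ , v₁) (p₂ , ne₂ , end₂ , v₂) =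
  trailing-zeros-injective w₁ w₂ k₂ k₁ fracEq end₁ end₂
  where
  k₁ = length w₁
  k₂ = length w₂
  U₁ = p₁ ++ w₁ ++ replicate k₂ false
  U₂ = p₂ ++ w₂ ++ replicate k₁ false
  valEq : valPos U₁ ≡ valPos U₂
  valEq = trans (valPos-shifted N p₁ w₁ k₂ v₁)
         (trans (cong (λ k → mulφ^ k (+ N , + 0)) (ℕ.+-comm k₁ k₂)) (sym (valPos-shifted N p₂ w₂ k₁ v₂)))
  ZinvEq : Zinv U₁ ≡ Zinv U₂
  ZinvEq = ℤ.+-injective (trans (Zinv-valPos U₁)
    (trans (cong (λ x → proj₁ x ℤ.+ (proj₂ x ℤ.+ proj₂ x)) valEq) (sym (Zinv-valPos U₂))))
  noEleven : ∀ p w k → NoEleven (p ++ w) → NoEleven (p ++ w ++ replicate k false)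
  noEleven p w k h = subst NoEleven (List.++-assoc p w _) (NoEleven-++-zeros (p ++ w) k h)
  L₁ = length U₁
  L₂ = length U₂
  paddedEq : replicate L₂ false ++ U₁ ≡ replicate L₁ false ++ U₂
  paddedEq = Zinv-injective _ _
    (trans (length-replicate-++ L₂ U₁) (trans (ℕ.+-comm L₂ L₁) (sym (length-replicate-++ L₁ U₂))))
    (NoEleven-zeros-++ L₂ U₁ (noEleven p₁ w₁ k₂ ne₁)) (NoEleven-zeros-++ L₁ U₂ (noEleven p₂ w₂ k₁ ne₂))
    (trans (Zinv-replicate-false L₂ U₁) (trans ZinvEq (sym (Zinv-replicate-false L₁ U₂))))
    where
    length-replicate-++ : ∀ k (u : Word) → length (replicate k false ++ u) ≡ k + length u
    length-replicate-++ k u = trans (List.length-++ (replicate k false)) (cong (_+ length u) (List.length-replicate k))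
  regroup : ∀ (z p w r : Word) → z ++ p ++ w ++ r ≡ (z ++ p) ++ (w ++ r)
  regroup z p w r = sym (List.++-assoc z p (w ++ r))
  fracEq : w₁ ++ replicate k₂ false ≡ w₂ ++ replicate k₁ false
  fracEq = ++-cancel-suffix-length (replicate L₂ false ++ p₁) (replicate L₁ false ++ p₂) _ _
    (trans (length-++-replicate w₁ k₂) (trans (ℕ.+-comm k₁ k₂) (sym (length-++-replicate w₂ k₁))))
    (trans (sym (regroup (replicate L₂ false) p₁ w₁ _)) (trans paddedEq (regroup (replicate L₁ false) p₂ w₂ _)))

-- Runs and their children

-- A run is a maximal block of consecutive integers N, N + 1, … with the same word
-- β⁻ = word: one integer when word starts with 1, three when it starts with 0.  int i is the
-- nonnegative part of the expansion of N + i; int₁ is kept for runs of length one as well,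
-- because their children use it.
record Run : Set where
  constructor run
  field
    word int₀ int₁ int₂ : Word
open Run

d00 d01 d10 : Word
d00 = false ∷ false ∷ []
d01 = false ∷ true ∷ []
d10 = true ∷ false ∷ []

child10 child00 child01 : Run → Run
child10 (run s q₀ q₁ q₂) = run (true ∷ false ∷ s) (q₀ ++ d00) (q₀ ++ d01) []
child00 (run s q₀ q₁ q₂) = run (false ∷ false ∷ s) (q₀ ++ d10) (q₁ ++ d00) (q₁ ++ d01)
child01 (run s q₀ q₁ q₂) = run (false ∷ true ∷ s) (q₁ ++ d10) (q₂ ++ d00) (q₂ ++ d01)

children : Run → List Run
children (run [] _ _ _) = []
children r@(run (true ∷ _) _ _ _) = child10 r ∷ child00 r ∷ []
children r@(run (false ∷ _) _ _ _) = child10 r ∷ child00 r ∷ child01 r ∷ []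

-- runs m lists the runs of Ξ_{m+1} in increasing order.
runs : ℕ → List Run
runs zero = run (false ∷ true ∷ []) (true ∷ false ∷ []) (true ∷ false ∷ false ∷ []) (true ∷ false ∷ true ∷ []) ∷ []
runs (suc m) = concatMap children (runs m)

leading : Run → Bool
leading (run [] _ _ _) = true
leading (run (x ∷ _) _ _ _) = x

runStart : ℤφ → ℤ
runStart (a , b) = a ℤ.+ a ℤ.+ b ℤ.- + 1

-- intPart I v is the integer part of the expansion of runStart v + I with fractional value v.
intPart : ℤ → ℤφ → ℤφ
intPart I (a , b) = (I ℤ.+ a ℤ.+ b ℤ.- + 1 , ℤ.- b)

step : Bool → ℤ
step true = + 1
step false = + 2

nextNeg : Bool → ℤφ → ℤφ
nextNeg x (a , b) = (a ℤ.+ step x , b ℤ.- + 1)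

prepend : Bool → Bool → ℤφ → ℤφ
prepend c d v = mulφinv (addDigit c (mulφinv (addDigit d v)))

-- In intPart-shift and in the two lemmas on nextNeg below, the hypotheses are the components
-- of the identity once the coordinates of v cancel; in every instance they are closed and hold
-- by refl.
intPart-shift : ∀ I J x y c d → I ℤ.+ digitℤ y ≡ J ℤ.+ digitℤ d → I ℤ.+ digitℤ x ℤ.- + 1 ≡ digitℤ d ℤ.- digitℤ c →
  ∀ v → horner (intPart I v) (x ∷ y ∷ []) ≡ intPart J (prepend c d v)
intPart-shift I J x y c d e₁ e₂ (a , b) = cong₂ _,_
  (trans (lhs₁ I a b (digitℤ y)) (trans (cong (λ z → z ℤ.+ (a ℤ.- + 1)) e₁) (sym (rhs₁ J a b (digitℤ c) (digitℤ d)))))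
  (trans (lhs₂ I a b (digitℤ x)) (trans (cong (λ z → z ℤ.+ (a ℤ.- b)) e₂) (sym (rhs₂ a b (digitℤ c) (digitℤ d)))))
  where
  lhs₁ : ∀ (I a b δy : ℤ) → ((I ℤ.+ a ℤ.+ b ℤ.- + 1) ℤ.+ ℤ.- b) ℤ.+ δy ≡ (I ℤ.+ δy) ℤ.+ (a ℤ.- + 1)
  lhs₁ = solve-∀
  rhs₁ : ∀ (J a b δc δd : ℤ) →
    J ℤ.+ ((a ℤ.+ δd) ℤ.- ((b ℤ.- (a ℤ.+ δd)) ℤ.+ δc)) ℤ.+ ((b ℤ.- (a ℤ.+ δd)) ℤ.+ δc) ℤ.- + 1
    ≡ (J ℤ.+ δd) ℤ.+ (a ℤ.- + 1)
  rhs₁ = solve-∀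
  lhs₂ : ∀ (I a b δx : ℤ) → (ℤ.- b ℤ.+ δx) ℤ.+ ((I ℤ.+ a ℤ.+ b ℤ.- + 1) ℤ.+ ℤ.- b)
    ≡ (I ℤ.+ δx ℤ.- + 1) ℤ.+ (a ℤ.- b)
  lhs₂ = solve-∀
  rhs₂ : ∀ (a b δc δd : ℤ) → ℤ.- ((b ℤ.- (a ℤ.+ δd)) ℤ.+ δc) ≡ (δd ℤ.- δc) ℤ.+ (a ℤ.- b)
  rhs₂ = solve-∀

-- c φ⁻¹ + d φ⁻² = (2d - c) + (c - d) φ
digitPair₀ digitPair₁ : Bool → Bool → ℤ
digitPair₀ c d = digitℤ d ℤ.+ digitℤ d ℤ.- digitℤ c
digitPair₁ c d = digitℤ c ℤ.- digitℤ d

prepend-closed : ∀ c d a b → prepend c d (a , b)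
  ≡ (digitPair₀ c d ℤ.+ (a ℤ.+ a ℤ.- b) , digitPair₁ c d ℤ.+ (b ℤ.- a))
prepend-closed c d a b = cong₂ _,_ (first a b (digitℤ c) (digitℤ d)) (second a b (digitℤ c) (digitℤ d))
  where
  first : ∀ (a b δc δd : ℤ) → (a ℤ.+ δd) ℤ.- ((b ℤ.- (a ℤ.+ δd)) ℤ.+ δc) ≡ (δd ℤ.+ δd ℤ.- δc) ℤ.+ (a ℤ.+ a ℤ.- b)
  first = solve-∀
  second : ∀ (a b δc δd : ℤ) → (b ℤ.- (a ℤ.+ δd)) ℤ.+ δc ≡ (δc ℤ.- δd) ℤ.+ (b ℤ.- a)
  second = solve-∀

nextNeg-prepend : ∀ x c d c′ d′ →
  digitPair₀ c d ℤ.+ step x ≡ digitPair₀ c′ d′ → digitPair₁ c d ℤ.- + 1 ≡ digitPair₁ c′ d′ →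
  ∀ v → nextNeg x (prepend c d v) ≡ prepend c′ d′ v
nextNeg-prepend x c d c′ d′ e₀ e₁ (a , b) = begin
  nextNeg x (prepend c d (a , b))
    ≡⟨ cong (nextNeg x) (prepend-closed c d a b) ⟩
  (digitPair₀ c d ℤ.+ (a ℤ.+ a ℤ.- b) ℤ.+ step x , digitPair₁ c d ℤ.+ (b ℤ.- a) ℤ.- + 1)
    ≡⟨ cong₂ _,_ (swap (digitPair₀ c d) _ (step x)) (swap (digitPair₁ c d) _ (ℤ.- + 1)) ⟩
  ((digitPair₀ c d ℤ.+ step x) ℤ.+ (a ℤ.+ a ℤ.- b) , (digitPair₁ c d ℤ.- + 1) ℤ.+ (b ℤ.- a))
    ≡⟨ cong₂ _,_ (cong (λ z → z ℤ.+ (a ℤ.+ a ℤ.- b)) e₀) (cong (λ z → z ℤ.+ (b ℤ.- a)) e₁) ⟩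
  (digitPair₀ c′ d′ ℤ.+ (a ℤ.+ a ℤ.- b) , digitPair₁ c′ d′ ℤ.+ (b ℤ.- a))
    ≡⟨ prepend-closed c′ d′ a b ⟨
  prepend c′ d′ (a , b) ∎
  where
  open ≡-Reasoning
  swap : ∀ (p e s : ℤ) → p ℤ.+ e ℤ.+ s ≡ (p ℤ.+ s) ℤ.+ e
  swap = solve-∀

prepend-nextNeg : ∀ x c d y c′ d′ →
  digitPair₀ c d ℤ.+ (step x ℤ.+ step x ℤ.+ + 1) ≡ digitPair₀ c′ d′ ℤ.+ step y →
  digitPair₁ c d ℤ.- step x ≡ digitPair₁ c′ d′ →
  ∀ v → prepend c d (nextNeg x v) ≡ nextNeg y (prepend c′ d′ v)
prepend-nextNeg x c d y c′ d′ e₀ e₁ (a , b) = begin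
  prepend c d (a ℤ.+ step x , b ℤ.- + 1)
    ≡⟨ prepend-closed c d (a ℤ.+ step x) (b ℤ.- + 1) ⟩
  (digitPair₀ c d ℤ.+ ((a ℤ.+ step x) ℤ.+ (a ℤ.+ step x) ℤ.- (b ℤ.- + 1)) ,
   digitPair₁ c d ℤ.+ ((b ℤ.- + 1) ℤ.- (a ℤ.+ step x)))
    ≡⟨ cong₂ _,_ (first (digitPair₀ c d) (step x) a b) (second (digitPair₁ c d) (step x) a b) ⟩
  ((digitPair₀ c d ℤ.+ (step x ℤ.+ step x ℤ.+ + 1)) ℤ.+ (a ℤ.+ a ℤ.- b) ,
   (digitPair₁ c d ℤ.- step x) ℤ.+ ((b ℤ.- a) ℤ.- + 1))
    ≡⟨ cong₂ _,_ (cong (λ z → z ℤ.+ (a ℤ.+ a ℤ.- b)) e₀) (cong (λ z → z ℤ.+ ((b ℤ.- a) ℤ.- + 1)) e₁) ⟩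
  ((digitPair₀ c′ d′ ℤ.+ step y) ℤ.+ (a ℤ.+ a ℤ.- b) , digitPair₁ c′ d′ ℤ.+ ((b ℤ.- a) ℤ.- + 1))
    ≡⟨ cong₂ _,_ (third (digitPair₀ c′ d′) (step y) (a ℤ.+ a ℤ.- b)) (fourth (digitPair₁ c′ d′) (b ℤ.- a)) ⟩
  nextNeg y (digitPair₀ c′ d′ ℤ.+ (a ℤ.+ a ℤ.- b) , digitPair₁ c′ d′ ℤ.+ (b ℤ.- a))
    ≡⟨ cong (nextNeg y) (prepend-closed c′ d′ a b) ⟨
  nextNeg y (prepend c′ d′ (a , b)) ∎
  where
  open ≡-Reasoning
  first : ∀ (p s a b : ℤ) → p ℤ.+ ((a ℤ.+ s) ℤ.+ (a ℤ.+ s) ℤ.- (b ℤ.- + 1))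
    ≡ (p ℤ.+ (s ℤ.+ s ℤ.+ + 1)) ℤ.+ (a ℤ.+ a ℤ.- b)
  first = solve-∀
  second : ∀ (p s a b : ℤ) → p ℤ.+ ((b ℤ.- + 1) ℤ.- (a ℤ.+ s)) ≡ (p ℤ.- s) ℤ.+ ((b ℤ.- a) ℤ.- + 1)
  second = solve-∀
  third : ∀ (p s e : ℤ) → (p ℤ.+ s) ℤ.+ e ≡ p ℤ.+ e ℤ.+ s
  third = solve-∀
  fourth : ∀ (p e : ℤ) → p ℤ.+ (e ℤ.- + 1) ≡ p ℤ.+ e ℤ.- + 1
  fourth = solve-∀

LongRunInvariant : Bool → Word → Word → ℤφ → Set
LongRunInvariant true q₁ q₂ v = ⊤
LongRunInvariant false q₁ q₂ v = NoEleven (q₁ ++ [ true ]) × NoEleven q₂ × valPos q₂ ≡ intPart (+ 2) v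

RunInvariant : Run → Set
RunInvariant (run [] q₀ q₁ q₂) = ⊥
RunInvariant (run (x ∷ s) q₀ q₁ q₂) =
  NoEleven (x ∷ s) × EmptyOrEndsIn1 (x ∷ s)
  × NoEleven (q₀ ++ [ true ]) × NoEleven q₁
  × valPos q₀ ≡ intPart (+ 0) (valNeg (x ∷ s)) × valPos q₁ ≡ intPart (+ 1) (valNeg (x ∷ s))
  × LongRunInvariant x q₁ q₂ (valNeg (x ∷ s))

-- RunsFrom v w rs: the runs rs are consecutive, the word of the first has value v, and w is
-- the value of the word following the last.
data RunsFrom : ℤφ → ℤφ → List Run → Set where
  end : ∀ {v} → RunsFrom v v []
  cons : ∀ {v w r rs} → valNeg (word r) ≡ v → RunInvariant r → RunsFrom (nextNeg (leading r) v) w rs →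
         RunsFrom v w (r ∷ rs)

EmptyOrEndsIn1-prepend : ∀ x y z s → EmptyOrEndsIn1 (z ∷ s) → EmptyOrEndsIn1 (x ∷ y ∷ z ∷ s)
EmptyOrEndsIn1-prepend x y z s (inj₁ ())
EmptyOrEndsIn1-prepend x y z s (inj₂ e) = inj₂ e

NoEleven-++-d00-∷ʳ-true : ∀ q → NoEleven q → NoEleven ((q ++ d00) ++ [ true ])
NoEleven-++-d00-∷ʳ-true q h = subst NoEleven (sym (List.++-assoc q d00 [ true ])) (NoEleven-++-false∷ q _ h tt)

NoEleven-++-d01 : ∀ q → NoEleven q → NoEleven (q ++ d01)
NoEleven-++-d01 q h = NoEleven-++-false∷ q _ h tt

NoEleven-++-d00 : ∀ q → NoEleven q → NoEleven (q ++ d00)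
NoEleven-++-d00 q h = NoEleven-++-false∷ q _ h tt

NoEleven-++-d10-∷ʳ-true : ∀ q → NoEleven (q ++ [ true ]) → NoEleven ((q ++ d10) ++ [ true ])
NoEleven-++-d10-∷ʳ-true q h = subst NoEleven (sym (List.++-assoc q d10 [ true ])) (NoEleven-glue q true _ h tt)

valPos-++-horner : ∀ q ds {x y} → valPos q ≡ x → horner x ds ≡ y → valPos (q ++ ds) ≡ y
valPos-++-horner q ds e₁ e₂ = trans (valPos-++ q ds) (trans (cong (λ x → horner x ds) e₁) e₂)

RunsFrom-∷ : ∀ {v v′ w r rs} → valNeg (word r) ≡ v → RunInvariant r → nextNeg (leading r) v ≡ v′ →
  RunsFrom v′ w rs → RunsFrom v w (r ∷ rs)
RunsFrom-∷ {w = w} {rs = rs} eq inv next h = cons eq inv (subst (λ x → RunsFrom x w rs) (sym next) h)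

nextNeg-child10 : ∀ v → nextNeg true (prepend true false v) ≡ prepend false false v
nextNeg-child10 = nextNeg-prepend true true false false false refl refl

nextNeg-child00 : ∀ v → nextNeg false (prepend false false v) ≡ prepend false true v
nextNeg-child00 = nextNeg-prepend false false false false true refl refl

nextNeg-child00-last : ∀ v → nextNeg false (prepend false false v) ≡ prepend true false (nextNeg true v)
nextNeg-child00-last v = sym (prepend-nextNeg true true false false false false refl refl v)

nextNeg-child01 : ∀ v → nextNeg false (prepend false true v) ≡ prepend true false (nextNeg false v)
nextNeg-child01 v = sym (prepend-nextNeg false true false false false true refl refl v)

int-child10₀ : ∀ v → horner (intPart (+ 0) v) d00 ≡ intPart (+ 0) (prepend true false v)
int-child10₀ = intPart-shift (+ 0) (+ 0) false false true false refl refl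

int-child10₁ : ∀ v → horner (intPart (+ 0) v) d01 ≡ intPart (+ 1) (prepend true false v)
int-child10₁ = intPart-shift (+ 0) (+ 1) false true true false refl refl

int-child00₀ : ∀ v → horner (intPart (+ 0) v) d10 ≡ intPart (+ 0) (prepend false false v)
int-child00₀ = intPart-shift (+ 0) (+ 0) true false false false refl refl

int-child00₁ : ∀ v → horner (intPart (+ 1) v) d00 ≡ intPart (+ 1) (prepend false false v)
int-child00₁ = intPart-shift (+ 1) (+ 1) false false false false refl refl

int-child00₂ : ∀ v → horner (intPart (+ 1) v) d01 ≡ intPart (+ 2) (prepend false false v)
int-child00₂ = intPart-shift (+ 1) (+ 2) false true false false refl refl

int-child01₀ : ∀ v → horner (intPart (+ 1) v) d10 ≡ intPart (+ 0) (prepend false true v)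
int-child01₀ = intPart-shift (+ 1) (+ 0) true false false true refl refl

int-child01₁ : ∀ v → horner (intPart (+ 2) v) d00 ≡ intPart (+ 1) (prepend false true v)
int-child01₁ = intPart-shift (+ 2) (+ 1) false false false true refl refl

int-child01₂ : ∀ v → horner (intPart (+ 2) v) d01 ≡ intPart (+ 2) (prepend false true v)
int-child01₂ = intPart-shift (+ 2) (+ 2) false true false true refl refl

child10-invariant : ∀ r → RunInvariant r → RunInvariant (child10 r)
child10-invariant (run [] _ _ _) ()
child10-invariant (run (x ∷ s) q₀ q₁ q₂) (ns , es , nq₀ , _ , vq₀ , _) =
  ns , EmptyOrEndsIn1-prepend true false x s es ,
  NoEleven-++-d00-∷ʳ-true q₀ nq₀′ , NoEleven-++-d01 q₀ nq₀′ ,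
  valPos-++-horner q₀ d00 vq₀ (int-child10₀ v) , valPos-++-horner q₀ d01 vq₀ (int-child10₁ v) , tt
  where
  v = valNeg (x ∷ s)
  nq₀′ = NoEleven-++⁻ˡ q₀ [ true ] nq₀

child00-invariant : ∀ r → RunInvariant r → RunInvariant (child00 r)
child00-invariant (run [] _ _ _) ()
child00-invariant (run (x ∷ s) q₀ q₁ q₂) (ns , es , nq₀ , nq₁ , vq₀ , vq₁ , _) =
  ns , EmptyOrEndsIn1-prepend false false x s es ,
  NoEleven-++-d10-∷ʳ-true q₀ nq₀ , NoEleven-++-d00 q₁ nq₁ ,
  valPos-++-horner q₀ d10 vq₀ (int-child00₀ v) , valPos-++-horner q₁ d00 vq₁ (int-child00₁ v) ,
  NoEleven-++-d00-∷ʳ-true q₁ nq₁ , NoEleven-++-d01 q₁ nq₁ , valPos-++-horner q₁ d01 vq₁ (int-child00₂ v)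
  where v = valNeg (x ∷ s)

child01-invariant : ∀ s q₀ q₁ q₂ → RunInvariant (run (false ∷ s) q₀ q₁ q₂) →
  RunInvariant (child01 (run (false ∷ s) q₀ q₁ q₂))
child01-invariant s q₀ q₁ q₂ (ns , es , _ , _ , _ , vq₁ , nq₁ , nq₂ , vq₂) =
  ns , EmptyOrEndsIn1-prepend false true false s es ,
  NoEleven-++-d10-∷ʳ-true q₁ nq₁ , NoEleven-++-d00 q₂ nq₂ ,
  valPos-++-horner q₁ d10 vq₁ (int-child01₀ v) , valPos-++-horner q₂ d00 vq₂ (int-child01₁ v) ,
  NoEleven-++-d00-∷ʳ-true q₂ nq₂ , NoEleven-++-d01 q₂ nq₂ , valPos-++-horner q₂ d01 vq₂ (int-child01₂ v)
  where v = valNeg (false ∷ s)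

children-RunsFrom : ∀ r v w rest → valNeg (word r) ≡ v → RunInvariant r →
  RunsFrom (prepend true false (nextNeg (leading r) v)) w rest →
  RunsFrom (prepend true false v) w (children r ++ rest)
children-RunsFrom (run [] _ _ _) v w rest eq () next
children-RunsFrom r@(run (true ∷ s) _ _ _) _ w rest refl inv next =
  RunsFrom-∷ refl (child10-invariant r inv) (nextNeg-child10 v) $
  RunsFrom-∷ refl (child00-invariant r inv) (nextNeg-child00-last v) next
  where v = valNeg (true ∷ s)
children-RunsFrom r@(run (false ∷ s) q₀ q₁ q₂) _ w rest refl inv next =
  RunsFrom-∷ refl (child10-invariant r inv) (nextNeg-child10 v) $
  RunsFrom-∷ refl (child00-invariant r inv) (nextNeg-child00 v) $
  RunsFrom-∷ refl (child01-invariant s q₀ q₁ q₂ inv) (nextNeg-child01 v) next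
  where v = valNeg (false ∷ s)

RunsFrom-children : ∀ v w rs → RunsFrom v w rs →
  RunsFrom (prepend true false v) (prepend true false w) (concatMap children rs)
RunsFrom-children v .v [] end = end
RunsFrom-children v w (r ∷ rs) (cons eq inv ch) =
  children-RunsFrom r v _ _ eq inv (RunsFrom-children (nextNeg (leading r) v) w rs ch)

double : ℕ → ℕ
double zero = zero
double (suc m) = suc (suc (double m))

-- The value of the word (10)^m 01, which starts level m.
levelNeg : ℕ → ℤφ
levelNeg m = (+ suc (fib (suc (suc (double m)))) , ℤ.- (+ fib (suc (double m))))

prepend10-levelNeg : ∀ m → prepend true false (levelNeg m) ≡ levelNeg (suc m)
prepend10-levelNeg m = trans (prepend-closed true false (+ 1 ℤ.+ F₂) (ℤ.- F₁)) (cong₂ _,_ (first F₂ F₁) (second F₂ F₁))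
  where
  F₂ = + fib (suc (suc (double m)))
  F₁ = + fib (suc (double m))
  first : ∀ (F₂ F₁ : ℤ) → digitPair₀ true false ℤ.+ ((+ 1 ℤ.+ F₂) ℤ.+ (+ 1 ℤ.+ F₂) ℤ.- ℤ.- F₁)
    ≡ + 1 ℤ.+ ((F₂ ℤ.+ F₁) ℤ.+ F₂)
  first = solve-∀
  second : ∀ (F₂ F₁ : ℤ) → digitPair₁ true false ℤ.+ (ℤ.- F₁ ℤ.- (+ 1 ℤ.+ F₂)) ≡ ℤ.- (F₂ ℤ.+ F₁)
  second = solve-∀

runs-RunsFrom : ∀ m → RunsFrom (levelNeg m) (levelNeg (suc m)) (runs m)
runs-RunsFrom zero = cons refl (tt , inj₂ refl , tt , tt , refl , refl , (tt , tt , refl)) end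
runs-RunsFrom (suc m) = subst₂ (λ v w → RunsFrom v w (runs (suc m))) (prepend10-levelNeg m) (prepend10-levelNeg (suc m))
  (RunsFrom-children _ _ (runs m) (runs-RunsFrom m))

IsExpansion : ℕ → Word → Word → Set
IsExpansion N p w = NoEleven (p ++ w) × EmptyOrEndsIn1 w × (valPos p +φ valNeg w) ≡ (+ N , + 0)

expansions : Run → List (Word × Word)
expansions (run [] q₀ q₁ q₂) = []
expansions (run (true ∷ s) q₀ q₁ q₂) = (q₀ , true ∷ s) ∷ []
expansions (run (false ∷ s) q₀ q₁ q₂) = (q₀ , false ∷ s) ∷ (q₁ , false ∷ s) ∷ (q₂ , false ∷ s) ∷ []

ExpansionsFrom : ℕ → List (Word × Word) → Set
ExpansionsFrom N [] = ⊤
ExpansionsFrom N ((p , w) ∷ xs) = IsExpansion N p w × ExpansionsFrom (suc N) xs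

ExpansionsFrom-++ : ∀ N xs ys → ExpansionsFrom N xs → ExpansionsFrom (N + length xs) ys →
  ExpansionsFrom N (xs ++ ys)
ExpansionsFrom-++ N [] ys _ h = subst (λ k → ExpansionsFrom k ys) (ℕ.+-identityʳ N) h
ExpansionsFrom-++ N ((p , w) ∷ xs) ys (e , es) h =
  e , ExpansionsFrom-++ (suc N) xs ys es (subst (λ k → ExpansionsFrom k ys) (ℕ.+-suc N (length xs)) h)

intPart-+φ : ∀ I v → intPart I v +φ v ≡ (I ℤ.+ runStart v , + 0)
intPart-+φ I (a , b) = cong₂ _,_ (first I a b) (ℤ.+-inverseˡ b)
  where
  first : ∀ (I a b : ℤ) → (I ℤ.+ a ℤ.+ b ℤ.- + 1) ℤ.+ a ≡ I ℤ.+ (a ℤ.+ a ℤ.+ b ℤ.- + 1)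
  first = solve-∀

runStart-nextNeg : ∀ x v → runStart (nextNeg x v) ≡ runStart v ℤ.+ (step x ℤ.+ step x ℤ.- + 1)
runStart-nextNeg x (a , b) = arith a b (step x)
  where
  arith : ∀ (a b s : ℤ) →
    (a ℤ.+ s) ℤ.+ (a ℤ.+ s) ℤ.+ (b ℤ.- + 1) ℤ.- + 1 ≡ (a ℤ.+ a ℤ.+ b ℤ.- + 1) ℤ.+ (s ℤ.+ s ℤ.- + 1)
  arith = solve-∀

intPart-IsExpansion : ∀ N I q s → NoEleven (q ++ s) → EmptyOrEndsIn1 s → valPos q ≡ intPart I (valNeg s) →
  + N ≡ I ℤ.+ runStart (valNeg s) → IsExpansion N q s
intPart-IsExpansion N I q s ne ends val start =
  ne , ends , trans (cong (_+φ valNeg s) val) (trans (intPart-+φ I (valNeg s)) (cong (_, + 0) (sym start)))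

run-expansions : ∀ r v N → valNeg (word r) ≡ v → RunInvariant r → + N ≡ runStart v →
  ExpansionsFrom N (expansions r) × + (N + length (expansions r)) ≡ runStart (nextNeg (leading r) v)
run-expansions (run [] q₀ q₁ q₂) v N eq () start
run-expansions (run (true ∷ s) q₀ q₁ q₂) v N refl (ns , es , nq₀ , _ , vq₀ , _) start =
  (intPart-IsExpansion N (+ 0) q₀ (true ∷ s) (NoEleven-glue q₀ true s nq₀ ns) es vq₀ start₀ , tt) ,
  trans (cong (λ z → z ℤ.+ + 1) start) (sym (runStart-nextNeg true v))
  where start₀ = trans start (sym (ℤ.+-identityˡ _))
run-expansions (run (false ∷ s) q₀ q₁ q₂) v N refl (ns , es , nq₀ , nq₁ , vq₀ , vq₁ , (_ , nq₂ , vq₂)) start =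
  (intPart-IsExpansion N (+ 0) q₀ S (NoEleven-++-false∷ q₀ s (NoEleven-++⁻ˡ q₀ [ true ] nq₀) ns) es vq₀ start₀ ,
   intPart-IsExpansion (suc N) (+ 1) q₁ S (NoEleven-++-false∷ q₁ s nq₁ ns) es vq₁ (cong (ℤ._+_ (+ 1)) start) ,
   intPart-IsExpansion (suc (suc N)) (+ 2) q₂ S (NoEleven-++-false∷ q₂ s nq₂ ns) es vq₂ (cong (ℤ._+_ (+ 2)) start) , tt) ,
  trans (cong (λ z → z ℤ.+ + 3) start) (sym (runStart-nextNeg false v))
  where
  S = false ∷ s
  start₀ = trans start (sym (ℤ.+-identityˡ _))

RunsFrom-expansions : ∀ v w rs N → RunsFrom v w rs → + N ≡ runStart v →
  ExpansionsFrom N (concatMap expansions rs) × + (N + length (concatMap expansions rs)) ≡ runStart w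
RunsFrom-expansions v .v [] N end start = tt , trans (cong +_ (ℕ.+-identityʳ N)) start
RunsFrom-expansions v w (r ∷ rs) N (cons eq inv ch) start
  with run-expansions r v N eq inv start
... | (here , next) with RunsFrom-expansions _ w rs _ ch next
... | (rest , last) =
  ExpansionsFrom-++ N (expansions r) _ here rest ,
  trans (cong +_ (trans (cong (λ k → N + k) (List.length-++ (expansions r))) (sym (ℕ.+-assoc N _ _)))) last

-- Zeckendorf indices of the run words

cValue : Word → ℕ
cValue w = Zinv (dropLast2 w)

modN-< : ∀ M y → y < M → modN M y ≡ y
modN-< zero y ()
modN-< (suc M) y h = ℕ.m<n⇒m%n≡m h

modN-+-self : ∀ M y → y < M → modN M (y + M) ≡ y
modN-+-self zero y ()
modN-+-self (suc M) y h = trans (ℕ.[m+n]%n≡m%n y (suc M)) (ℕ.m<n⇒m%n≡m h)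

dropLast2-∷∷ : ∀ a b S k → length S ≡ suc (suc k) → dropLast2 (a ∷ b ∷ S) ≡ a ∷ b ∷ dropLast2 S
dropLast2-∷∷ a b S k e = subst (λ l → take l (a ∷ b ∷ S) ≡ a ∷ b ∷ take (l ∸ 2) S) (sym e) refl

length-dropLast2 : ∀ S k → length S ≡ suc (suc k) → length (dropLast2 S) ≡ k
length-dropLast2 S k e = trans (List.length-take (length S ∸ 2) S)
  (trans (cong (λ l → (l ∸ 2) ⊓ l) e) (ℕ.m≤n⇒m⊓n≡m (ℕ.≤-trans (ℕ.n≤1+n k) (ℕ.n≤1+n (suc k)))))

cValue-∷∷ : ∀ a b S k → length S ≡ suc (suc k) →
  cValue (a ∷ b ∷ S) ≡ bit a * fib (suc (suc (suc k))) + (bit b * fib (suc (suc k)) + cValue S)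
cValue-∷∷ a b S k e
  rewrite dropLast2-∷∷ a b S k e | Zinv-∷ a (b ∷ dropLast2 S) | Zinv-∷ b (dropLast2 S)
        | length-dropLast2 S k e = refl

rotate : ℕ → ℕ → ℕ
rotate m x = modN (fib (suc (suc (double m)))) (x + fib (double m))

-- With c = cValue of a word of level m, the leading digit is 1 exactly when rotating c
-- wraps around; the invariant records the inequality each case needs.
LeadingBound : ℕ → Bool → ℕ → Set
LeadingBound m true c = fib (suc (double m)) ≤ c
LeadingBound m false c = c + fib (double m) < fib (suc (suc (double m)))

IndexInvariant : ℕ → Word → Set
IndexInvariant m [] = ⊥
IndexInvariant m (x ∷ s) =
  length (x ∷ s) ≡ suc (suc (double m)) × cValue (x ∷ s) < fib (suc (suc (double m)))
  × LeadingBound m x (cValue (x ∷ s))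

Rotating : ℕ → ℕ → List Word → Set
Rotating m x [] = ⊤
Rotating m x (w ∷ ws) = cValue w ≡ x × IndexInvariant m w × Rotating m (rotate m x) ws

Rotating-iterate : ∀ m x ws → Rotating m x ws → map cValue ws ≡ iterate (rotate m) x (length ws)
Rotating-iterate m x [] _ = refl
Rotating-iterate m x (w ∷ ws) (e , _ , h) = cong₂ _∷_ e (Rotating-iterate m (rotate m x) ws h)

childWords : Word → List Word
childWords [] = []
childWords (true ∷ s) = (true ∷ false ∷ true ∷ s) ∷ (false ∷ false ∷ true ∷ s) ∷ []
childWords (false ∷ s) = (true ∷ false ∷ false ∷ s) ∷ (false ∷ false ∷ false ∷ s) ∷ (false ∷ true ∷ false ∷ s) ∷ []

map-word-children : ∀ r → map word (children r) ≡ childWords (word r)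
map-word-children (run [] _ _ _) = refl
map-word-children (run (true ∷ s) _ _ _) = refl
map-word-children (run (false ∷ s) _ _ _) = refl

map-word-runs-suc : ∀ m → map word (runs (suc m)) ≡ concatMap childWords (map word (runs m))
map-word-runs-suc m = begin
  map word (concatMap children (runs m))              ≡⟨ List.map-concatMap word children (runs m) ⟩
  concatMap (λ r → map word (children r)) (runs m)   ≡⟨ List.concatMap-cong map-word-children (runs m) ⟩
  concatMap (λ r → childWords (word r)) (runs m)     ≡⟨ List.concatMap-map childWords word (runs m) ⟨
  concatMap childWords (map word (runs m))            ∎
  where open ≡-Reasoning

module _ (m : ℕ) where
  private
    F₀ = fib (double m)
    F₁ = fib (suc (double m))
    F₂ = fib (suc (suc (double m)))
    F₃ = fib (suc (suc (suc (double m))))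
    F₄ = fib (suc (suc (suc (suc (double m)))))

  cValue-10 : ∀ S → length S ≡ suc (suc (double m)) → cValue (true ∷ false ∷ S) ≡ cValue S + F₃
  cValue-10 S len = trans (cValue-∷∷ true false S _ len) (arith F₃ F₂ (cValue S))
    where
    arith : ∀ A B c → 1 * A + (0 * B + c) ≡ c + A
    arith = ℕ-Solver.solve-∀

  cValue-00 : ∀ S → length S ≡ suc (suc (double m)) → cValue (false ∷ false ∷ S) ≡ cValue S
  cValue-00 S len = cValue-∷∷ false false S _ len

  cValue-01 : ∀ S → length S ≡ suc (suc (double m)) → cValue (false ∷ true ∷ S) ≡ cValue S + F₂
  cValue-01 S len = trans (cValue-∷∷ false true S _ len) (arith F₃ F₂ (cValue S))
    where
    arith : ∀ A B c → 0 * A + (1 * B + c) ≡ c + B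
    arith = ℕ-Solver.solve-∀

  rotate-wraps : ∀ c → c < F₄ → rotate (suc m) (c + F₃) ≡ c
  rotate-wraps c c<F₄ = trans (cong (modN F₄) (ℕ.+-assoc c F₃ F₂)) (modN-+-self F₄ c c<F₄)

  rotate-small : ∀ c → c + F₂ < F₄ → rotate (suc m) c ≡ c + F₂
  rotate-small c = modN-< F₄ (c + F₂)

  -- rotating a word with leading 1 at level m wraps around: c + F₀ = (c - F₁) + F₂
  rotate-leading-1 : ∀ c → c < F₂ → F₁ ≤ c → rotate m c + F₃ ≡ c + F₂
  rotate-leading-1 c c<F₂ F₁≤c = begin
    modN F₂ (c + F₀) + F₃                 ≡⟨ cong (λ x → modN F₂ (x + F₀) + F₃) c≡F₁+t ⟨
    modN F₂ ((F₁ + t) + F₀) + F₃          ≡⟨ cong (λ x → modN F₂ x + F₃) (arith₁ t F₁ F₀) ⟩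
    modN F₂ (t + F₂) + F₃                 ≡⟨ cong (_+ F₃) (modN-+-self F₂ t t<F₂) ⟩
    t + F₃                                ≡⟨ arith₂ t F₁ F₀ ⟩
    (F₁ + t) + F₂                         ≡⟨ cong (_+ F₂) c≡F₁+t ⟩
    c + F₂                                ∎
    where
    open ≡-Reasoning
    t = c ∸ F₁
    c≡F₁+t : F₁ + t ≡ c
    c≡F₁+t = ℕ.m+[n∸m]≡n F₁≤c
    t<F₂ : t < F₂
    t<F₂ = ℕ.≤-<-trans (ℕ.m≤n+m t F₁) (subst (_< F₂) (sym c≡F₁+t) c<F₂)
    arith₁ : ∀ t A₁ A₀ → (A₁ + t) + A₀ ≡ t + (A₁ + A₀)
    arith₁ = ℕ-Solver.solve-∀
    arith₂ : ∀ t A₁ A₀ → t + ((A₁ + A₀) + A₁) ≡ (A₁ + t) + (A₁ + A₀)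
    arith₂ = ℕ-Solver.solve-∀

  rotate-leading-0 : ∀ c → c + F₀ < F₂ → rotate m c + F₃ ≡ c + F₂ + F₂
  rotate-leading-0 c h = trans (cong (_+ F₃) (modN-< F₂ (c + F₀) h)) (arith c F₁ F₀)
    where
    arith : ∀ c A₁ A₀ → c + A₀ + ((A₁ + A₀) + A₁) ≡ c + (A₁ + A₀) + (A₁ + A₀)
    arith = ℕ-Solver.solve-∀

  first-two-children : ∀ S → length S ≡ suc (suc (double m)) → cValue S < F₂ →
    ∀ rest → Rotating (suc m) (rotate (suc m) (cValue S)) rest →
    Rotating (suc m) (cValue S + F₃) ((true ∷ false ∷ S) ∷ (false ∷ false ∷ S) ∷ rest)
  first-two-children S len c<F₂ rest next =
    cValue-10 S len ,
    (len′ , subst (_< F₄) (sym (cValue-10 S len)) (subst (_< F₃ + F₂) (ℕ.+-comm F₃ c) (ℕ.+-monoʳ-< F₃ c<F₂)) ,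
            subst (F₃ ≤_) (sym (cValue-10 S len)) (ℕ.m≤n+m F₃ c)) ,
    trans (cValue-00 S len) (sym (rotate-wraps c c<F₄)) ,
    (len′ , subst (_< F₄) (sym (cValue-00 S len)) c<F₄ , subst (λ x → x + F₂ < F₄) (sym (cValue-00 S len)) c+F₂<F₄) ,
    subst (λ x → Rotating (suc m) (rotate (suc m) x) rest) (sym (rotate-wraps c c<F₄)) next
    where
    c = cValue S
    len′ = cong (λ l → suc (suc l)) len
    c<F₃ : c < F₃
    c<F₃ = ℕ.<-≤-trans c<F₂ (fib-mono (suc (suc (double m))))
    c<F₄ : c < F₄
    c<F₄ = ℕ.<-≤-trans c<F₃ (fib-mono (suc (suc (suc (double m)))))
    c+F₂<F₄ : c + F₂ < F₄
    c+F₂<F₄ = ℕ.+-monoˡ-< F₂ c<F₃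

  childWords-Rotating : ∀ w x rest → cValue w ≡ x → IndexInvariant m w →
    Rotating (suc m) (rotate m x + F₃) rest → Rotating (suc m) (x + F₃) (childWords w ++ rest)
  childWords-Rotating [] x rest eq () next
  childWords-Rotating (true ∷ s) _ rest refl (len , c<F₂ , F₁≤c) next =
    first-two-children (true ∷ s) len c<F₂ rest
      (subst (λ x → Rotating (suc m) x rest) after next)
    where
    c = cValue (true ∷ s)
    after : rotate m c + F₃ ≡ rotate (suc m) c
    after = trans (rotate-leading-1 c c<F₂ F₁≤c)
                  (sym (rotate-small c (ℕ.+-monoˡ-< F₂ (ℕ.<-≤-trans c<F₂ (fib-mono (suc (suc (double m))))))))
  childWords-Rotating (false ∷ s) _ rest refl (len , c<F₂ , c+F₀<F₂) next =
    first-two-children S len c<F₂ ((false ∷ true ∷ S) ∷ rest)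
      (trans (cValue-01 S len) (sym (rotate-small c c+F₂<F₄)) ,
       (cong (λ l → suc (suc l)) len , subst (_< F₄) (sym (cValue-01 S len)) c+F₂<F₄ ,
        subst (λ x → x + F₂ < F₄) (sym (cValue-01 S len)) c+F₂+F₂<F₄) ,
       subst (λ x → Rotating (suc m) x rest) after next)
    where
    S = false ∷ s
    c = cValue S
    c<F₁ : c < F₁
    c<F₁ = ℕ.+-cancelʳ-< F₀ c F₁ c+F₀<F₂
    c+F₂<F₃ : c + F₂ < F₃
    c+F₂<F₃ = subst (_< F₂ + F₁) (ℕ.+-comm F₂ c) (ℕ.+-monoʳ-< F₂ c<F₁)
    c+F₂<F₄ : c + F₂ < F₄
    c+F₂<F₄ = ℕ.<-≤-trans c+F₂<F₃ (fib-mono (suc (suc (suc (double m)))))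
    c+F₂+F₂<F₄ : c + F₂ + F₂ < F₄
    c+F₂+F₂<F₄ = ℕ.+-monoˡ-< F₂ c+F₂<F₃
    after : rotate m c + F₃ ≡ rotate (suc m) (rotate (suc m) c)
    after = trans (rotate-leading-0 c c+F₀<F₂)
      (sym (trans (cong (rotate (suc m)) (rotate-small c c+F₂<F₄)) (rotate-small (c + F₂) c+F₂+F₂<F₄)))

Rotating-childWords : ∀ m x ws → Rotating m x ws →
  Rotating (suc m) (x + fib (suc (suc (suc (double m))))) (concatMap childWords ws)
Rotating-childWords m x [] h = tt
Rotating-childWords m x (w ∷ ws) (e , inv , h) =
  childWords-Rotating m w x (concatMap childWords ws) e inv (Rotating-childWords m (rotate m x) ws h)

fib-suc-pos : ∀ k → 1 ≤ fib (suc k)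
fib-suc-pos zero = s≤s z≤n
fib-suc-pos (suc k) = ℕ.≤-trans (fib-suc-pos k) (ℕ.m≤m+n (fib (suc k)) (fib k))

runs-Rotating : ∀ m → Rotating m (fib (suc (suc (double m))) ∸ 1) (map word (runs m))
runs-Rotating zero = refl , (refl , s≤s z≤n , s≤s z≤n) , tt
runs-Rotating (suc m) =
  subst₂ (Rotating (suc m)) (∸-+-comm (fib-suc-pos (suc (double m)))) (sym (map-word-runs-suc m))
    (Rotating-childWords m _ (map word (runs m)) (runs-Rotating m))
  where
  ∸-+-comm : ∀ {a b} → 1 ≤ a → (a ∸ 1) + b ≡ (b + a) ∸ 1
  ∸-+-comm {suc a} {b} _ = trans (ℕ.+-comm a b) (sym (cong (_∸ 1) (ℕ.+-suc b a)))

-- Counting and distinctness of the run words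

proj₂-nextNeg : ∀ x v → proj₂ (nextNeg x v) ≡ proj₂ v ℤ.- + 1
proj₂-nextNeg x (a , b) = refl

-- Every run lowers the φ-coefficient of the value of the word by one.
RunsFrom-length : ∀ v w rs → RunsFrom v w rs → + length rs ≡ proj₂ v ℤ.- proj₂ w
RunsFrom-length v .v [] end = sym (ℤ.+-inverseʳ (proj₂ v))
RunsFrom-length v w (r ∷ rs) (cons _ _ h) =
  trans (cong (ℤ._+_ (+ 1)) (trans (RunsFrom-length _ w rs h) (cong (ℤ._- proj₂ w) (proj₂-nextNeg (leading r) v))))
        (arith (proj₂ v) (proj₂ w))
  where
  arith : ∀ (b c : ℤ) → + 1 ℤ.+ ((b ℤ.- + 1) ℤ.- c) ≡ b ℤ.- c
  arith = solve-∀

length-runs : ∀ m → length (runs m) ≡ fib (suc (suc (double m)))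
length-runs m = ℤ.+-injective (trans (RunsFrom-length _ _ (runs m) (runs-RunsFrom m))
  (arith (+ fib (suc (double m))) (+ fib (double m))))
  where
  arith : ∀ (F₁ F₀ : ℤ) → ℤ.- F₁ ℤ.- ℤ.- ((F₁ ℤ.+ F₀) ℤ.+ F₁) ≡ F₁ ℤ.+ F₀
  arith = solve-∀

expansionWords : List Run → List Word
expansionWords rs = map proj₂ (concatMap expansions rs)

expansionWords-∷ : ∀ r rs → RunInvariant r →
  Σ ℕ λ k → expansionWords (r ∷ rs) ≡ replicate (suc k) (word r) ++ expansionWords rs
expansionWords-∷ (run [] _ _ _) rs ()
expansionWords-∷ (run (true ∷ s) _ _ _) rs _ = 0 , refl
expansionWords-∷ (run (false ∷ s) _ _ _) rs _ = 2 , refl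

RunsFrom-expansionWords-≤ : ∀ v w rs → RunsFrom v w rs →
  All (λ u → proj₂ (valNeg u) ℤ.≤ proj₂ v) (expansionWords rs)
RunsFrom-expansionWords-≤ v w [] _ = All.[]
RunsFrom-expansionWords-≤ v w (r ∷ rs) (cons eq inv h) with expansionWords-∷ r rs inv
... | k , e rewrite e =
  All.++⁺ (All.replicate⁺ (suc k) (ℤ.≤-reflexive (cong proj₂ eq)))
          (All.map (λ {u} → weaken u) (RunsFrom-expansionWords-≤ _ w rs h))
  where
  next≤ : proj₂ (nextNeg (leading r) v) ℤ.≤ proj₂ v
  next≤ = ℤ.≤-trans (ℤ.≤-reflexive (proj₂-nextNeg (leading r) v)) (ℤ.i-j≤i (proj₂ v) (+ 1))
  weaken : ∀ u → proj₂ (valNeg u) ℤ.≤ proj₂ (nextNeg (leading r) v) → proj₂ (valNeg u) ℤ.≤ proj₂ v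
  weaken u below = ℤ.≤-trans below next≤

_≟w_ : (u v : Word) → Dec (u ≡ v)
_≟w_ = List.≡-dec Bool._≟_

deduplicate-replicate-++ : ∀ k (x : Word) ys → All (λ y → ¬ x ≡ y) ys →
  deduplicate _≟w_ (replicate (suc k) x ++ ys) ≡ x ∷ deduplicate _≟w_ ys
deduplicate-replicate-++ zero x ys ≢ys = cong (x ∷_) (List.filter-all (¬? ∘ _≟w_ x) (All.deduplicate⁺ _≟w_ ≢ys))
deduplicate-replicate-++ (suc k) x ys ≢ys = cong (x ∷_) (begin
  filter (¬? ∘ _≟w_ x) (deduplicate _≟w_ (replicate (suc k) x ++ ys))
    ≡⟨ cong (filter (¬? ∘ _≟w_ x)) (deduplicate-replicate-++ k x ys ≢ys) ⟩
  filter (¬? ∘ _≟w_ x) (x ∷ deduplicate _≟w_ ys)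
    ≡⟨ List.filter-reject (¬? ∘ _≟w_ x) (λ ¬x≡x → ¬x≡x refl) ⟩
  filter (¬? ∘ _≟w_ x) (deduplicate _≟w_ ys)
    ≡⟨ List.filter-all (¬? ∘ _≟w_ x) (All.deduplicate⁺ _≟w_ ≢ys) ⟩
  deduplicate _≟w_ ys
    ∎)
  where open ≡-Reasoning

-- Later runs have words of strictly smaller φ-coefficient, so all run words are distinct.
deduplicate-expansionWords : ∀ v w rs → RunsFrom v w rs → deduplicate _≟w_ (expansionWords rs) ≡ map word rs
deduplicate-expansionWords v w [] _ = refl
deduplicate-expansionWords v w (r ∷ rs) (cons eq inv h) with expansionWords-∷ r rs inv
... | k , e rewrite e =
  trans (deduplicate-replicate-++ k (word r) _ (All.map later≢ (RunsFrom-expansionWords-≤ _ w rs h)))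
        (cong (word r ∷_) (deduplicate-expansionWords _ w rs h))
  where
  later≢ : ∀ {u} → proj₂ (valNeg u) ℤ.≤ proj₂ (nextNeg (leading r) v) → ¬ word r ≡ u
  later≢ below refl = ℤ.<-irrefl refl (ℤ.i≤pred[j]⇒i<j (begin
    proj₂ v                       ≡⟨ cong proj₂ eq ⟨
    proj₂ (valNeg (word r))       ≤⟨ below ⟩
    proj₂ (nextNeg (leading r) v) ≡⟨ proj₂-nextNeg (leading r) v ⟩
    proj₂ v ℤ.- + 1               ≡⟨ ℤ.+-comm (proj₂ v) _ ⟩
    ℤ.pred (proj₂ v)              ∎))
    where open ℤ.≤-Reasoning

lucas-suc : ∀ k → lucas (suc k) ≡ fib k + fib (suc (suc k))
lucas-suc zero = refl
lucas-suc (suc zero) = refl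
lucas-suc (suc (suc k)) rewrite lucas-suc (suc k) | lucas-suc k = arith (fib (suc k)) (fib k)
  where
  arith : ∀ y x → (y + ((y + x) + y)) + (x + (y + x)) ≡ (y + x) + (((y + x) + y) + (y + x))
  arith = ℕ-Solver.solve-∀

runStart-levelNeg : ∀ m → runStart (levelNeg m) ≡ + (lucas (suc (double m)) + 1)
runStart-levelNeg m rewrite lucas-suc (double m) = arith (+ fib (suc (double m))) (+ fib (double m))
  where
  arith : ∀ (F₁ F₀ : ℤ) → (+ 1 ℤ.+ (F₁ ℤ.+ F₀)) ℤ.+ (+ 1 ℤ.+ (F₁ ℤ.+ F₀)) ℤ.+ ℤ.- F₁ ℤ.- + 1
        ≡ (F₀ ℤ.+ (F₁ ℤ.+ F₀)) ℤ.+ + 1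
  arith = solve-∀

levelExpansions : ℕ → List (Word × Word)
levelExpansions m = concatMap expansions (runs m)

-- Level m covers Ξ_{m+1} = [L_{2m+1} + 1, L_{2m+3}].
runs-expansions : ∀ m →
  ExpansionsFrom (lucas (suc (double m)) + 1) (levelExpansions m)
  × lucas (suc (double m)) + 1 + length (levelExpansions m) ≡ lucas (suc (double (suc m))) + 1
runs-expansions m with RunsFrom-expansions _ _ (runs m) _ (runs-RunsFrom m) (sym (runStart-levelNeg m))
... | expansionsFrom , last = expansionsFrom , ℤ.+-injective (trans last (runStart-levelNeg (suc m)))

ExpansionsFrom-lookup : ∀ N xs i → ExpansionsFrom N xs → i < length xs → Σ Word λ p → Σ Word λ w → IsExpansion (N + i) p w
ExpansionsFrom-lookup N ((p , w) ∷ xs) zero (e , _) _ = p , w , subst (λ k → IsExpansion k p w) (sym (ℕ.+-identityʳ N)) e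
ExpansionsFrom-lookup N ((p , w) ∷ xs) (suc i) (_ , es) (s≤s i<) with ExpansionsFrom-lookup (suc N) xs i es i<
... | p′ , w′ , e = p′ , w′ , subst (λ k → IsExpansion k p′ w′) (sym (ℕ.+-suc N i)) e

ExpansionsFrom-β⁻ : ∀ (b : ℕ → Word) N xs (at : ℕ → ℕ) → (∀ i → at i ≡ N + i) → ExpansionsFrom N xs →
  (∀ i → i < length xs → IsBetaMinus (at i) (b (at i))) → applyUpTo (λ i → b (at i)) (length xs) ≡ map proj₂ xs
ExpansionsFrom-β⁻ b N [] at at≡ _ _ = refl
ExpansionsFrom-β⁻ b N ((p , w) ∷ xs) at at≡ (e , es) hb =
  cong₂ _∷_ (IsBetaMinus-unique (at 0) _ w (hb 0 (s≤s z≤n))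
               (p , subst (λ k → IsExpansion k p w) (sym (trans (at≡ 0) (ℕ.+-identityʳ N))) e))
            (ExpansionsFrom-β⁻ b (suc N) xs (λ i → at (suc i)) (λ i → trans (at≡ (suc i)) (ℕ.+-suc N i)) es
               (λ i i< → hb (suc i) (s≤s i<)))

*-2≡double : ∀ m → 2 * m ≡ double m
*-2≡double zero = refl
*-2≡double (suc m) = trans (ℕ.*-suc 2 m) (cong (λ k → suc (suc k)) (*-2≡double m))

module Level (m : ℕ) where
  private
    start = lucas (suc (double m)) + 1
    xs = levelExpansions m
    start+length≡ : start + length xs ≡ lucas (suc (double (suc m))) + 1
    start+length≡ = proj₂ (runs-expansions m)

  lucas-lower : lucas (2 * suc m ∸ 1) ≡ lucas (suc (double m))
  lucas-lower = cong (λ k → lucas (k ∸ 1)) (*-2≡double (suc m))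

  lucas-upper : lucas (2 * suc m + 1) ≡ lucas (suc (double (suc m)))
  lucas-upper = cong lucas (trans (cong (λ k → k + 1) (*-2≡double (suc m))) (ℕ.+-comm (double (suc m)) 1))

  InXi-bounds : ∀ {N} → InXi (suc m) N → start ≤ N × N < start + length xs
  InXi-bounds {N} (lo , hi) rewrite lucas-lower | lucas-upper | start+length≡ =
    lo , subst (N <_) (ℕ.+-comm 1 (lucas (suc (double (suc m))))) (s≤s hi)

  length-levelExpansions : length xs ≡ lucas (2 * suc m + 1) ∸ lucas (2 * suc m ∸ 1)
  length-levelExpansions rewrite lucas-lower | lucas-upper =
    sym (trans (cong (_∸ lucas (suc (double m))) L′≡L+length) (ℕ.m+n∸m≡n (lucas (suc (double m))) (length xs)))
    where
    arith : ∀ l k → (l + k) + 1 ≡ (l + 1) + k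
    arith = ℕ-Solver.solve-∀
    L′≡L+length : lucas (suc (double (suc m))) ≡ lucas (suc (double m)) + length xs
    L′≡L+length = ℕ.+-cancelʳ-≡ 1 _ _ (sym (trans (arith (lucas (suc (double m))) (length xs)) start+length≡))

  β⁻-exists : ∀ N → InXi (suc m) N → ∃ λ w → IsBetaMinus N w
  β⁻-exists N inXi with InXi-bounds inXi
  ... | lo , hi with ExpansionsFrom-lookup start xs (N ∸ start) (proj₁ (runs-expansions m))
                       (ℕ.+-cancelˡ-< start _ _ (subst (_< start + length xs) (sym (ℕ.m+[n∸m]≡n lo)) hi))
  ... | p , w , e = w , p , subst (λ k → IsExpansion k p w) (ℕ.m+[n∸m]≡n lo) e

  distinctWords≡runWords : ∀ b → (∀ N → InXi (suc m) N → IsBetaMinus N (b N)) → distinctWords b (suc m)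
    ≡ map word (runs m)
  distinctWords≡runWords b hb =
    trans (cong (deduplicate _≟w_) b-on-Xi) (deduplicate-expansionWords _ _ (runs m) (runs-RunsFrom m))
    where
    b-on-Xi : map b (Xi (suc m)) ≡ expansionWords (runs m)
    b-on-Xi = begin
      map b (Xi (suc m))                                            ≡⟨ List.map-∘ (upTo _) ⟨
      map (λ i → b (lucas (2 * suc m ∸ 1) + 1 + i)) (upTo _)         ≡⟨ List.map-applyUpTo id _ _ ⟩
      applyUpTo (λ i → b (lucas (2 * suc m ∸ 1) + 1 + i)) _          ≡⟨ cong (applyUpTo _) length-levelExpansions ⟨
      applyUpTo (λ i → b (lucas (2 * suc m ∸ 1) + 1 + i)) (length xs)
        ≡⟨ ExpansionsFrom-β⁻ b start xs _ (λ i → cong (λ l → l + 1 + i) lucas-lower) (proj₁ (runs-expansions m))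
             (λ i i< → hb _ (InXi-at i i<)) ⟩
      expansionWords (runs m)                                        ∎
      where
      open ≡-Reasoning
      InXi-at : ∀ i → i < length xs → InXi (suc m) (lucas (2 * suc m ∸ 1) + 1 + i)
      InXi-at i i< rewrite lucas-lower | lucas-upper =
        ℕ.m≤m+n start i ,
        ℕ.≤-pred (subst (suc (start + i) ≤_) (trans start+length≡ (ℕ.+-comm _ 1)) (ℕ.+-monoʳ-< start i<))

  orbit≡iterate-rotate :
    orbit (suc m) ≡ iterate (rotate m) (fib (suc (suc (double m))) ∸ 1) (fib (suc (suc (double m))))
  orbit≡iterate-rotate = at (2 * suc m) (*-2≡double (suc m))
    where
    at : ∀ K → K ≡ suc (suc (double m)) →
      iterate (λ x → modN (fib K) (x + fib (K ∸ 2))) (fib K ∸ 1) (fib K)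
      ≡ iterate (rotate m) (fib (suc (suc (double m))) ∸ 1) (fib (suc (suc (double m))))
    at _ refl = refl

theorem7p6 : (n : ℕ) → 1 ≤ n →
    ((N : ℕ) → InXi n N → ∃ λ w → IsBetaMinus N w)
    × ((b : ℕ → Word) → ((N : ℕ) → InXi n N → IsBetaMinus N (b N)) →
        (length (distinctWords b n) ≡ fib (2 * n)) × (cSeq b n ≡ orbit n))
theorem7p6 zero ()
theorem7p6 (suc m) _ = β⁻-exists , λ b hb →
  let words≡ = distinctWords≡runWords b hb
  in trans (cong length words≡) count , trans (cong (map cValue) words≡) sequence
  where
  open Level m
  count : length (map word (runs m)) ≡ fib (2 * suc m)
  count = trans (List.length-map word (runs m)) (trans (length-runs m) (cong fib (sym (*-2≡double (suc m)))))
  sequence : map cValue (map word (runs m)) ≡ orbit (suc m)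
  sequence = begin
    map cValue (map word (runs m))
      ≡⟨ Rotating-iterate m _ _ (runs-Rotating m) ⟩
    iterate (rotate m) (fib (suc (suc (double m))) ∸ 1) (length (map word (runs m)))
      ≡⟨ cong (iterate (rotate m) _) (trans (List.length-map word (runs m)) (length-runs m)) ⟩
    iterate (rotate m) (fib (suc (suc (double m))) ∸ 1) (fib (suc (suc (double m))))
      ≡⟨ orbit≡iterate-rotate ⟨
    orbit (suc m) ∎
    where open ≡-Reasoning
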